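{- Let $1\leq a<b\leq n$. Every edge of every directed path in the Bruhat graph of $S_n$ from $e$ to the transposition $(a\ b)$ is labeled by an element of $T_{ab}:=\{(i\ j)\mid a\leq i<j\leq b\}$.
   Context: $S_n$ is the symmetric group on $[n]$, the Coxeter group of type $A_{n-1}$ with simple reflections $(i\ i+1)$, reflections $T$ = all transpositions, permutations composed as functions (right to left), and length $\ell(\sigma)$ = number of pairs $i<j$ with $\sigma(i)>\sigma(j)$. The Bruhat graph of $S_n$ has vertex set $S_n$ and a directed edge $x\xrightarrow{t}y$ labeled $t\in T$ iff $y=tx$ and $\ell(x)<\ell(y)$. -}

module Defs where

open import Data.Nat using (ℕ; zero; suc)
open import Data.Nat.Base using () renaming (_<_ to _<ℕ_)
open import Data.Fin using (Fin; toℕ; _<_; _≤_; _<?_)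
open import Data.Fin.Permutation using (Permutation′; _⟨$⟩ʳ_; transpose)
import Data.Fin.Permutation as P
open import Data.List using (List; length; filter; concatMap; map)
open import Data.List.Base using (allFin)
open import Data.Product using (_×_; _,_)
open import Data.Product.Properties using ()
open import Relation.Nullary.Decidable using (_×-dec_)
open import Relation.Binary.PropositionalEquality using (_≡_)

-- S_n : permutations of Fin n  (Fin n represents [n], k ↦ k+1)
Perm : ℕ → Set
Perm n = Permutation′ n

e : ∀ {n} → Perm n
e = P.id

tr : ∀ {n} → Fin n → Fin n → Perm n
tr i j = transpose i j

pairs : ∀ n → List (Fin n × Fin n)
pairs n = concatMap (λ i → map (λ j → (i , j)) (allFin n)) (allFin n)

len : ∀ {n} → Perm n → ℕ
len {n} σ = length (filter (λ { (i , j) → (i <? j) ×-dec ((σ ⟨$⟩ʳ j) <? (σ ⟨$⟩ʳ i)) }) (pairs n))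

_≈_ : ∀ {n} → Perm n → Perm n → Set
σ ≈ τ = ∀ k → σ ⟨$⟩ʳ k ≡ τ ⟨$⟩ʳ k

-- Bruhat edge x --(i j)--> y, for the transposition t = (i j) with i < j:
-- y = t x (composition as functions, t applied after x) and ℓ(x) < ℓ(y)
record Edge {n} (x : Perm n) (i j : Fin n) (y : Perm n) : Set where
  field
    lab< : i < j
    mult : ∀ k → y ⟨$⟩ʳ k ≡ tr i j ⟨$⟩ʳ (x ⟨$⟩ʳ k)
    incr : len x <ℕ len y

-- directed path in the Bruhat graph from x to y, edge by edge
-- (each transposition is named once, by its pair i < j)
data BPath {n} : Perm n → Perm n → Set where
  done : ∀ {x y} → x ≈ y → BPath x y
  step : ∀ {x z y} (i j : Fin n) → Edge x i j z → BPath z y → BPath x y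

data LabelsIn {n} (a b : Fin n) : ∀ {x y : Perm n} → BPath x y → Set where
  done : ∀ {x y : Perm n} {p : _≈_ {n} x y} → LabelsIn a b {x} {y} (BPath.done {n} p)
  step : ∀ {x z y} {i j : Fin n} {E : Edge {n} x i j z} {q : BPath z y} →
         a ≤ i → j ≤ b → LabelsIn a b {z} {y} q → LabelsIn a b {x} {y} (BPath.step {n} i j E q)

-- Reading a Bruhat path to (a b) backwards, every vertex z fixes all points outside [a, b].
-- If an edge x → z had label (i j) with i < a, then z⁻¹(i) = i < z⁻¹(j), and a transposition
-- of two values occurring in increasing order never shortens a permutation, so ℓ(z) ≤ ℓ(x),
-- contradicting the edge; symmetrically for j > b. Since the label then lies in [a, b],
-- x = (i j) z again fixes everything outside [a, b].

module Submission where

open import Defs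
open import Data.Nat using (ℕ)
open import Data.Fin using (Fin; _<_)

import Data.Nat as ℕ
open import Data.Nat.Properties using (≤-<-trans; <-≤-trans; ≮⇒≥; ≤⇒≯)
open import Data.Fin using (_≤_; _≟_; _<?_)
open import Data.Fin.Properties using (<-trans; <-asym; <⇒≢; ≤∧≢⇒<; injective⇒≤)
open import Data.Fin.Permutation using (_⟨$⟩ʳ_; _⟨$⟩ˡ_; inverseˡ; inverseʳ)
import Data.Fin.Permutation.Components as PC
open import Data.List using (List; []; _∷_; _++_; length; filter; lookup; concatMap; map; cartesianProduct; allFin)
open import Data.List.Relation.Unary.Any using (index)
open import Data.List.Relation.Unary.Any.Properties using (lookup-index)
import Data.List.Relation.Unary.All as All
open import Data.List.Relation.Unary.AllPairs using (_∷_)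
open import Data.List.Relation.Unary.Unique.Propositional using (Unique)
open import Data.List.Relation.Unary.Unique.Propositional.Properties using (filter⁺; cartesianProduct⁺; allFin⁺)
open import Data.List.Membership.Propositional using (_∈_)
open import Data.List.Membership.Propositional.Properties using (∈-lookup; ∈-filter⁺; ∈-filter⁻; ∈-cartesianProduct⁺; ∈-allFin)
open import Data.Product using (_×_; _,_; proj₁; proj₂)
open import Data.Sum using (_⊎_; inj₁; inj₂)
open import Data.Empty using (⊥-elim)
open import Relation.Nullary using (Dec; yes; no; ¬_)
open import Relation.Nullary.Decidable using (dec-true; dec-false)
open import Relation.Unary using (Decidable)
open import Relation.Binary.PropositionalEquality
open import Function using (_∘_)

lookup-injective : ∀ {A : Set} {xs : List A} → Unique xs →
                   ∀ {k l} → lookup xs k ≡ lookup xs l → k ≡ l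
lookup-injective (_ ∷ _)        {Fin.zero}  {Fin.zero}  _  = refl
lookup-injective (x∉xs ∷ _)     {Fin.zero}  {Fin.suc l} eq = ⊥-elim (All.lookup x∉xs (∈-lookup l) eq)
lookup-injective (x∉xs ∷ _)     {Fin.suc k} {Fin.zero}  eq = ⊥-elim (All.lookup x∉xs (∈-lookup k) (sym eq))
lookup-injective (_ ∷ xs-uniq)  {Fin.suc k} {Fin.suc l} eq = cong Fin.suc (lookup-injective xs-uniq eq)

length-≤-injection : ∀ {A B : Set} {xs : List A} {ys : List B} (f : A → B) → Unique xs →
                     (∀ {x y} → x ∈ xs → y ∈ xs → f x ≡ f y → x ≡ y) →
                     (∀ {x} → x ∈ xs → f x ∈ ys) →
                     length xs ℕ.≤ length ys
length-≤-injection {xs = xs} {ys} f xs-uniq f-inj f-into = injective⇒≤ index-f-injective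
  where
  index-f : Fin (length xs) → Fin (length ys)
  index-f k = index (f-into (∈-lookup k))
  index-f-injective : ∀ {k l} → index-f k ≡ index-f l → k ≡ l
  index-f-injective {k} {l} eq = lookup-injective xs-uniq (f-inj (∈-lookup k) (∈-lookup l) (begin
    f (lookup xs k)              ≡⟨ lookup-index (f-into (∈-lookup k)) ⟩
    lookup ys (index-f k)        ≡⟨ cong (lookup ys) eq ⟩
    lookup ys (index-f l)        ≡⟨ lookup-index (f-into (∈-lookup l)) ⟨
    f (lookup xs l)              ∎))
    where open ≡-Reasoning

length-filter-≤ : ∀ {A : Set} {P Q : A → Set} (P? : Decidable P) (Q? : Decidable Q)
                  {xs : List A} (f : A → A) → Unique xs → (∀ x → x ∈ xs) →
                  (∀ {x y} → P x → P y → f x ≡ f y → x ≡ y) → (∀ {x} → P x → Q (f x)) →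
                  length (filter P? xs) ℕ.≤ length (filter Q? xs)
length-filter-≤ P? Q? {xs} f xs-uniq xs-complete f-inj f-pres =
  length-≤-injection f (filter⁺ P? xs-uniq)
    (λ x∈ y∈ → f-inj (proj₂ (∈-filter⁻ P? {xs = xs} x∈)) (proj₂ (∈-filter⁻ P? {xs = xs} y∈)))
    (λ x∈ → ∈-filter⁺ Q? (xs-complete _) (f-pres (proj₂ (∈-filter⁻ P? {xs = xs} x∈))))

concatMap-pairs≡cartesianProduct : ∀ {A B : Set} (xs : List A) (ys : List B) →
  concatMap (λ x → map (λ y → (x , y)) ys) xs ≡ cartesianProduct xs ys
concatMap-pairs≡cartesianProduct []       ys = refl
concatMap-pairs≡cartesianProduct (x ∷ xs) ys =
  cong (map (x ,_) ys ++_) (concatMap-pairs≡cartesianProduct xs ys)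

pairs-unique : ∀ n → Unique (pairs n)
pairs-unique n rewrite concatMap-pairs≡cartesianProduct (allFin n) (allFin n) =
  cartesianProduct⁺ (allFin⁺ n) (allFin⁺ n)

∈-pairs : ∀ {n} (x : Fin n × Fin n) → x ∈ pairs n
∈-pairs {n} (k , l) rewrite concatMap-pairs≡cartesianProduct (allFin n) (allFin n) =
  ∈-cartesianProduct⁺ (∈-allFin k) (∈-allFin l)

module _ {n : ℕ} where

  transpose-first : (i j : Fin n) → PC.transpose i j i ≡ j
  transpose-first i j rewrite dec-true (i ≟ i) refl = refl

  transpose-second : (i j : Fin n) → PC.transpose i j j ≡ i
  transpose-second i j with i ≟ j
  ... | yes refl = transpose-first i i
  ... | no i≢j rewrite dec-false (j ≟ i) (i≢j ∘ sym) | dec-true (j ≟ j) refl = refl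

  transpose-fixes : (i j : Fin n) {k : Fin n} → k ≢ i → k ≢ j → PC.transpose i j k ≡ k
  transpose-fixes i j {k} k≢i k≢j rewrite dec-false (k ≟ i) k≢i | dec-false (k ≟ j) k≢j = refl

  transpose-involutive : (i j k : Fin n) → PC.transpose i j (PC.transpose i j k) ≡ k
  transpose-involutive i j k = by-cases (k ≟ i) (k ≟ j)
    where
    by-cases : Dec (k ≡ i) → Dec (k ≡ j) → PC.transpose i j (PC.transpose i j k) ≡ k
    by-cases (yes refl) _ = trans (cong (PC.transpose k j) (transpose-first k j)) (transpose-second k j)
    by-cases (no _) (yes refl) = trans (cong (PC.transpose i k) (transpose-second i k)) (transpose-first i k)
    by-cases (no k≢i) (no k≢j) =
      trans (cong (PC.transpose i j) (transpose-fixes i j k≢i k≢j)) (transpose-fixes i j k≢i k≢j)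

  transpose-conjugate : (σ : Perm n) (i j k : Fin n) →
                        PC.transpose (σ ⟨$⟩ʳ i) (σ ⟨$⟩ʳ j) (σ ⟨$⟩ʳ k) ≡ σ ⟨$⟩ʳ PC.transpose i j k
  transpose-conjugate σ i j k = by-cases (k ≟ i) (k ≟ j)
    where
    σ-injective : ∀ {k l} → σ ⟨$⟩ʳ k ≡ σ ⟨$⟩ʳ l → k ≡ l
    σ-injective {k} {l} eq = trans (sym (inverseˡ σ)) (trans (cong (σ ⟨$⟩ˡ_) eq) (inverseˡ σ))
    by-cases : Dec (k ≡ i) → Dec (k ≡ j) →
               PC.transpose (σ ⟨$⟩ʳ i) (σ ⟨$⟩ʳ j) (σ ⟨$⟩ʳ k) ≡ σ ⟨$⟩ʳ PC.transpose i j k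
    by-cases (yes refl) _ = trans (transpose-first (σ ⟨$⟩ʳ k) (σ ⟨$⟩ʳ j)) (cong (σ ⟨$⟩ʳ_) (sym (transpose-first k j)))
    by-cases (no _) (yes refl) = trans (transpose-second (σ ⟨$⟩ʳ i) (σ ⟨$⟩ʳ k)) (cong (σ ⟨$⟩ʳ_) (sym (transpose-second i k)))
    by-cases (no k≢i) (no k≢j) = trans (transpose-fixes (σ ⟨$⟩ʳ i) (σ ⟨$⟩ʳ j) (k≢i ∘ σ-injective) (k≢j ∘ σ-injective))
                                       (cong (σ ⟨$⟩ʳ_) (sym (transpose-fixes i j k≢i k≢j)))

module _ {A : Set} {O : A → Set} (O? : Decidable O) (f : A → A) where

  flipIf : ∀ {x} → Dec (O (f x)) → A
  flipIf {x} (yes _) = f x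
  flipIf {x} (no _)  = x

  flipWhen : A → A
  flipWhen x = flipIf (O? (f x))

  flipWhen-injective : (∀ x → f (f x) ≡ x) →
                       ∀ {x y} → O x → O y → flipWhen x ≡ flipWhen y → x ≡ y
  flipWhen-injective f-involutive {x} {y} Ox Oy = by-cases (O? (f x)) (O? (f y))
    where
    by-cases : (dx : Dec (O (f x))) (dy : Dec (O (f y))) → flipIf dx ≡ flipIf dy → x ≡ y
    by-cases (yes _)    (yes _)    eq = trans (sym (f-involutive x)) (trans (cong f eq) (f-involutive y))
    by-cases (yes _)    (no ¬Ofy)  eq = ⊥-elim (¬Ofy (subst O (trans (sym (f-involutive x)) (cong f eq)) Ox))
    by-cases (no ¬Ofx)  (yes _)    eq = ⊥-elim (¬Ofx (subst O (sym (trans (cong f eq) (f-involutive y))) Oy))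
    by-cases (no _)     (no _)     eq = eq

module _ {n : ℕ} where

  Ordered : Fin n × Fin n → Set
  Ordered (k , l) = k < l

  -- The predicate counted by len, up to eta for pairs.
  Inversion : Perm n → Fin n × Fin n → Set
  Inversion σ (k , l) = k < l × σ ⟨$⟩ʳ l < σ ⟨$⟩ʳ k

  swapPair : Fin n → Fin n → Fin n × Fin n → Fin n × Fin n
  swapPair r s (k , l) = PC.transpose r s k , PC.transpose r s l

  swapPair-involutive : (r s : Fin n) (x : Fin n × Fin n) → swapPair r s (swapPair r s x) ≡ x
  swapPair-involutive r s (k , l) = cong₂ _,_ (transpose-involutive r s k) (transpose-involutive r s l)

  ordered? : Decidable Ordered
  ordered? (k , l) = k <? l

  transpose-disorders : ∀ {r s k l : Fin n} → r < s → k < l →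
    ¬ (PC.transpose r s k < PC.transpose r s l) →
    (k ≡ r × l < s) ⊎ (k ≡ r × l ≡ s) ⊎ (r < k × l ≡ s)
  transpose-disorders {r} {s} {k} {l} r<s k<l disordered = by-cases (k ≟ r) (k ≟ s) (l ≟ r) (l ≟ s)
    where
    by-cases : Dec (k ≡ r) → Dec (k ≡ s) → Dec (l ≡ r) → Dec (l ≡ s) →
               (k ≡ r × l < s) ⊎ (k ≡ r × l ≡ s) ⊎ (r < k × l ≡ s)
    by-cases (yes refl) _ _ (yes refl) = inj₂ (inj₁ (refl , refl))
    by-cases (yes refl) _ _ (no l≢s) = inj₁ (refl , ≤∧≢⇒< (≮⇒≥ (disordered ∘ ordered)) l≢s)
      where
      ordered : s < l → PC.transpose k s k < PC.transpose k s l
      ordered s<l rewrite transpose-first k s | transpose-fixes k s (<⇒≢ k<l ∘ sym) l≢s = s<l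
    by-cases (no k≢r) (yes refl) _ _ =
      ⊥-elim (disordered (subst₂ _<_ (sym (transpose-second r k)) (sym τl≡l) (<-trans r<s k<l)))
      where
      τl≡l : PC.transpose r k l ≡ l
      τl≡l = transpose-fixes r k (<⇒≢ (<-trans r<s k<l) ∘ sym) (<⇒≢ k<l ∘ sym)
    by-cases (no k≢r) (no k≢s) _ (yes refl) = inj₂ (inj₂ (≤∧≢⇒< (≮⇒≥ (disordered ∘ ordered)) (k≢r ∘ sym) , refl))
      where
      ordered : k < r → PC.transpose r l k < PC.transpose r l l
      ordered k<r rewrite transpose-fixes r l k≢r k≢s | transpose-second r l = k<r
    by-cases (no k≢r) (no k≢s) (yes refl) (no _) =
      ⊥-elim (disordered (subst₂ _<_ (sym (transpose-fixes l s k≢r k≢s)) (sym (transpose-first l s)) (<-trans k<l r<s)))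
    by-cases (no k≢r) (no k≢s) (no l≢r) (no l≢s) =
      ⊥-elim (disordered (subst₂ _<_ (sym (transpose-fixes r s k≢r k≢s)) (sym (transpose-fixes r s l≢r l≢s)) k<l))

  -- Inversions (k , l) of σ are sent to (τ k , τ l) when that pair is still ordered; the
  -- remaining ones (see transpose-disorders) stay inversions of σ ∘ τ because σ r < σ s.
  len-≤-transposeʳ : (σ σ' : Perm n) {r s : Fin n} → r < s → σ ⟨$⟩ʳ r < σ ⟨$⟩ʳ s →
                     (∀ k → σ' ⟨$⟩ʳ k ≡ σ ⟨$⟩ʳ PC.transpose r s k) → len σ ℕ.≤ len σ'
  len-≤-transposeʳ σ σ' {r} {s} r<s σr<σs σ'≡σ∘τ =
    length-filter-≤ _ _ ψ (pairs-unique n) ∈-pairs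
      (λ inv₁ inv₂ → flipWhen-injective ordered? (swapPair r s) (swapPair-involutive r s) (proj₁ inv₁) (proj₁ inv₂))
      preserves
    where
    τ : Fin n → Fin n
    τ = PC.transpose r s
    ψ : Fin n × Fin n → Fin n × Fin n
    ψ = flipWhen ordered? (swapPair r s)
    σ'∘τ≡σ : ∀ m → σ' ⟨$⟩ʳ τ m ≡ σ ⟨$⟩ʳ m
    σ'∘τ≡σ m = trans (σ'≡σ∘τ (τ m)) (cong (σ ⟨$⟩ʳ_) (transpose-involutive r s m))
    σ'≡σ-off : ∀ {m} → m ≢ r → m ≢ s → σ' ⟨$⟩ʳ m ≡ σ ⟨$⟩ʳ m
    σ'≡σ-off m≢r m≢s = trans (σ'≡σ∘τ _) (cong (σ ⟨$⟩ʳ_) (transpose-fixes r s m≢r m≢s))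
    preserves : ∀ {x} → Inversion σ x → Inversion σ' (ψ x)
    preserves {k , l} (k<l , σl<σk) = by-cases (τ k <? τ l)
      where
      by-cases : (d : Dec (τ k < τ l)) → Inversion σ' (flipIf ordered? (swapPair r s) {k , l} d)
      by-cases (yes τk<τl) = τk<τl , subst₂ _<_ (sym (σ'∘τ≡σ l)) (sym (σ'∘τ≡σ k)) σl<σk
      by-cases (no disordered) with transpose-disorders r<s k<l disordered
      ... | inj₁ (refl , l<s) =
        k<l , subst₂ _<_ (sym (σ'≡σ-off (<⇒≢ k<l ∘ sym) (<⇒≢ l<s)))
                         (sym (trans (σ'≡σ∘τ k) (cong (σ ⟨$⟩ʳ_) (transpose-first k s))))
                         (<-trans σl<σk σr<σs)
      ... | inj₂ (inj₁ (refl , refl)) = ⊥-elim (<-asym σr<σs σl<σk)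
      ... | inj₂ (inj₂ (r<k , refl)) =
        k<l , subst₂ _<_ (sym (trans (σ'≡σ∘τ l) (cong (σ ⟨$⟩ʳ_) (transpose-second r l))))
                         (sym (σ'≡σ-off (<⇒≢ r<k ∘ sym) (<⇒≢ k<l)))
                         (<-trans σr<σs σl<σk)

  len-≤-transposeˡ : (z x : Perm n) {u v : Fin n} → u < v → z ⟨$⟩ˡ u < z ⟨$⟩ˡ v →
                     (∀ k → x ⟨$⟩ʳ k ≡ PC.transpose u v (z ⟨$⟩ʳ k)) → len z ℕ.≤ len x
  len-≤-transposeˡ z x {u} {v} u<v z⁻¹u<z⁻¹v x≡τ∘z =
    len-≤-transposeʳ z x z⁻¹u<z⁻¹v (subst₂ _<_ (sym (inverseʳ z)) (sym (inverseʳ z)) u<v) λ k → begin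
      x ⟨$⟩ʳ k                                                   ≡⟨ x≡τ∘z k ⟩
      PC.transpose u v (z ⟨$⟩ʳ k)                                 ≡⟨ cong₂ (λ u v → PC.transpose u v (z ⟨$⟩ʳ k))
                                                                           (sym (inverseʳ z)) (sym (inverseʳ z)) ⟩
      PC.transpose (z ⟨$⟩ʳ (z ⟨$⟩ˡ u)) (z ⟨$⟩ʳ (z ⟨$⟩ˡ v)) (z ⟨$⟩ʳ k) ≡⟨ transpose-conjugate z _ _ k ⟩
      z ⟨$⟩ʳ PC.transpose (z ⟨$⟩ˡ u) (z ⟨$⟩ˡ v) k                 ∎
    where open ≡-Reasoning

  FixesBelow : Fin n → Perm n → Set
  FixesBelow a σ = ∀ k → k < a → σ ⟨$⟩ʳ k ≡ k

  FixesAbove : Fin n → Perm n → Set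
  FixesAbove b σ = ∀ k → b < k → σ ⟨$⟩ʳ k ≡ k

  FixesOutside : Fin n → Fin n → Perm n → Set
  FixesOutside a b σ = FixesBelow a σ × FixesAbove b σ

  inverse-fixes : (σ : Perm n) {k : Fin n} → σ ⟨$⟩ʳ k ≡ k → σ ⟨$⟩ˡ k ≡ k
  inverse-fixes σ σk≡k = trans (cong (σ ⟨$⟩ˡ_) (sym σk≡k)) (inverseˡ σ)

  len-≤-transpose-below : ∀ {a i j : Fin n} (z x : Perm n) → FixesBelow a z → i < j → i < a →
                          (∀ k → x ⟨$⟩ʳ k ≡ PC.transpose i j (z ⟨$⟩ʳ k)) → len z ℕ.≤ len x
  len-≤-transpose-below {a} {i} {j} z x fixes i<j i<a =
    len-≤-transposeˡ z x i<j (subst (_< z ⟨$⟩ˡ j) (sym (inverse-fixes z (fixes i i<a))) i<z⁻¹j)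
    where
    i<z⁻¹j : i < z ⟨$⟩ˡ j
    i<z⁻¹j with z ⟨$⟩ˡ j <? a
    ... | yes z⁻¹j<a = subst (i <_) (trans (sym (inverseʳ z)) (fixes _ z⁻¹j<a)) i<j
    ... | no z⁻¹j≮a = <-≤-trans i<a (≮⇒≥ z⁻¹j≮a)

  len-≤-transpose-above : ∀ {b i j : Fin n} (z x : Perm n) → FixesAbove b z → i < j → b < j →
                          (∀ k → x ⟨$⟩ʳ k ≡ PC.transpose i j (z ⟨$⟩ʳ k)) → len z ℕ.≤ len x
  len-≤-transpose-above {b} {i} {j} z x fixes i<j b<j =
    len-≤-transposeˡ z x i<j (subst (z ⟨$⟩ˡ i <_) (sym (inverse-fixes z (fixes j b<j))) z⁻¹i<j)
    where
    z⁻¹i<j : z ⟨$⟩ˡ i < j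
    z⁻¹i<j with b <? z ⟨$⟩ˡ i
    ... | yes b<z⁻¹i = subst (_< j) (trans (sym (inverseʳ z)) (fixes _ b<z⁻¹i)) i<j
    ... | no b≮z⁻¹i = ≤-<-trans (≮⇒≥ b≮z⁻¹i) b<j

  Edge-source : ∀ {x z : Perm n} {i j : Fin n} → Edge x i j z →
                ∀ k → x ⟨$⟩ʳ k ≡ PC.transpose i j (z ⟨$⟩ʳ k)
  Edge-source {x} {i = i} {j} E k =
    trans (sym (transpose-involutive i j (x ⟨$⟩ʳ k))) (cong (PC.transpose i j) (sym (Edge.mult E k)))

  Edge-label-within : ∀ {a b i j : Fin n} {x z : Perm n} → FixesOutside a b z → Edge x i j z → a ≤ i × j ≤ b
  Edge-label-within {a} {b} {i} {j} {x} {z} (below , above) E = a≤i , j≤b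
    where
    open Edge E
    a≤i : a ≤ i
    a≤i with i <? a
    ... | yes i<a = ⊥-elim (≤⇒≯ (len-≤-transpose-below z x below lab< i<a (Edge-source E)) incr)
    ... | no i≮a = ≮⇒≥ i≮a
    j≤b : j ≤ b
    j≤b with b <? j
    ... | yes b<j = ⊥-elim (≤⇒≯ (len-≤-transpose-above z x above lab< b<j (Edge-source E)) incr)
    ... | no b≮j = ≮⇒≥ b≮j

  Edge-fixesOutside : ∀ {a b i j : Fin n} {x z : Perm n} → a ≤ i → j ≤ b →
                      FixesOutside a b z → Edge x i j z → FixesOutside a b x
  Edge-fixesOutside {a} {b} {i} {j} {x} a≤i j≤b (below , above) E = fixes-below , fixes-above
    where
    i<j : i < j
    i<j = Edge.lab< E
    fixes-below : FixesBelow a x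
    fixes-below k k<a = trans (Edge-source E k) (trans (cong (PC.transpose i j) (below k k<a))
      (transpose-fixes i j (<⇒≢ k<i) (<⇒≢ (<-trans k<i i<j))))
      where
      k<i : k < i
      k<i = <-≤-trans k<a a≤i
    fixes-above : FixesAbove b x
    fixes-above k b<k = trans (Edge-source E k) (trans (cong (PC.transpose i j) (above k b<k))
      (transpose-fixes i j (<⇒≢ (<-trans i<j j<k) ∘ sym) (<⇒≢ j<k ∘ sym)))
      where
      j<k : j < k
      j<k = ≤-<-trans j≤b b<k

  BPath-labels-within : ∀ {a b : Fin n} {x y : Perm n} (p : BPath x y) →
                        FixesOutside a b y → FixesOutside a b x × LabelsIn a b p
  BPath-labels-within (BPath.done x≈y) (below , above) =
    ((λ k k<a → trans (x≈y k) (below k k<a)) , (λ k b<k → trans (x≈y k) (above k b<k))) , LabelsIn.done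
  BPath-labels-within (BPath.step i j E p) fixes-y with BPath-labels-within p fixes-y
  ... | fixes-z , labels-p with Edge-label-within fixes-z E
  ...   | a≤i , j≤b = Edge-fixesOutside a≤i j≤b fixes-z E , LabelsIn.step a≤i j≤b labels-p

  transpose-fixesOutside : ∀ {a b : Fin n} → a < b → FixesOutside a b (tr a b)
  transpose-fixesOutside {a} {b} a<b =
    (λ k k<a → transpose-fixes a b (<⇒≢ k<a) (<⇒≢ (<-trans k<a a<b))) ,
    (λ k b<k → transpose-fixes a b (<⇒≢ (<-trans a<b b<k) ∘ sym) (<⇒≢ b<k ∘ sym))

mainTheorem4 : (n : ℕ) (a b : Fin n) → a < b →
    (p : BPath (e {n}) (tr a b)) → LabelsIn a b p
mainTheorem4 n a b a<b p = proj₂ (BPath-labels-within p (transpose-fixesOutside a<b))
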